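{- Let $m$ and $n$ be relatively prime positive integers. Perform the Euclidean algorithm with $n^2$ and $mn + 1$. Then the first remainder $r$ that is less than $n$ is the multiplicative inverse of $m$ modulo $n$, i.e. $m r \equiv 1 \pmod{n}$.
   Context: The Euclidean algorithm with positive integers $u$ and $v$: set $r_{ -1} = u$, $r_0 = v$, and for $i \ge 1$ write $r_{i-2} = q_i r_{i-1} + r_i$ with $0 \le r_i < r_{i-1}$ (division with remainder), stopping at the first index $s$ with $r_s = 0$. The $r_i$ with $i\ge 1$ are the remainders. -}

module Defs where

open import Data.Nat using (ℕ; zero; suc; _%_; NonZero)
open import Data.Nat.Base using (_≡ᵇ_)
open import Data.Bool using (if_then_else_)
open import Data.Product using (_×_; _,_; proj₂)

-- Remainder sequence of the Euclidean algorithm started with r₋₁ = u, r₀ = v.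
-- pairAt u v i = (r_{i-1} , r_i).  Once a zero remainder appears the
-- sequence is frozen (the algorithm has stopped); the statement only refers
-- to indices up to the first zero remainder.
pairAt : ℕ → ℕ → ℕ → ℕ × ℕ
pairAt u v zero = u , v
pairAt u v (suc i) with pairAt u v i
... | (a , zero)  = a , zero
... | (a , suc b) = suc b , a % suc b

rem : ℕ → ℕ → ℕ → ℕ
rem u v i = proj₂ (pairAt u v i)

{-# OPTIONS --safe #-}

-- Along the Euclidean algorithm on u = n² and v = mn + 1 track the signed Bézout cofactors
-- tᵢ with rᵢ ≡ tᵢ v (mod n²).  They alternate in sign and satisfy |tᵢ| rᵢ₋₁ + |tᵢ₋₁| rᵢ = n²,
-- so at the first remainder r = rᵢ < n ≤ rᵢ₋₁ we have |tᵢ| ≤ n, and since v ≡ 1 (mod n) also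
-- tᵢ ≡ r (mod n).  If tᵢ < 0 this forces |tᵢ| + r = n, and r + |tᵢ| v ≡ 0 (mod n²) becomes
-- n (1 + m |tᵢ|) ≡ 0 (mod n²), i.e. m r = m (n - |tᵢ|) ≡ 1 (mod n).  If tᵢ ≥ 0 then either
-- tᵢ = r, and n² ∣ m n r gives n ∣ r by coprimality, or tᵢ = n, r = 0 and n² ∣ n v; both
-- are impossible unless n = 1.
module Submission where

open import Data.Empty using (⊥-elim)
open import Data.List using (_∷_; [])
open import Data.Nat
open import Data.Nat.Coprimality using (Coprime; coprime-divisor) renaming (sym to Coprime-sym)
open import Data.Nat.Divisibility
open import Data.Nat.DivMod
open import Data.Nat.Properties
open import Data.Nat.Tactic.RingSolver using (solve)
open import Data.Product using (∃; ∃₂; Σ; _×_; _,_; proj₁)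
open import Data.Sum using (_⊎_; inj₁; inj₂; [_,_]′)
open import Level using (0ℓ)
open import Relation.Binary.Bundles using (Setoid)
open import Relation.Binary.PropositionalEquality
import Relation.Binary.Reasoning.Setoid as SetoidReasoning
open import Relation.Nullary using (¬_; yes; no)
open import Relation.Unary using (Pred; Decidable)

open import Defs

infix 4 _≡_[mod_]

_≡_[mod_] : ℕ → ℕ → ℕ → Set
x ≡ y [mod N ] = ∃₂ λ k l → x + k * N ≡ y + l * N

module _ {N : ℕ} where

  ≡-mod-refl : ∀ {x} → x ≡ x [mod N ]
  ≡-mod-refl = 0 , 0 , refl

  ≡-mod-sym : ∀ {x y} → x ≡ y [mod N ] → y ≡ x [mod N ]
  ≡-mod-sym (k , l , e) = l , k , sym e

  ≡-mod-trans : ∀ {x y z} → x ≡ y [mod N ] → y ≡ z [mod N ] → x ≡ z [mod N ]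
  ≡-mod-trans {x} {y} {z} (k , l , e) (k′ , l′ , e′) = k + k′ , l′ + l , (begin
    x + (k + k′) * N     ≡⟨ solve (x ∷ k ∷ k′ ∷ N ∷ []) ⟩
    (x + k * N) + k′ * N ≡⟨ cong (_+ k′ * N) e ⟩
    (y + l * N) + k′ * N ≡⟨ solve (y ∷ l ∷ k′ ∷ N ∷ []) ⟩
    (y + k′ * N) + l * N ≡⟨ cong (_+ l * N) e′ ⟩
    (z + l′ * N) + l * N ≡⟨ solve (z ∷ l′ ∷ l ∷ N ∷ []) ⟩
    z + (l′ + l) * N     ∎)
    where open ≡-Reasoning

  +-cong-mod : ∀ {x y u w} → x ≡ y [mod N ] → u ≡ w [mod N ] → x + u ≡ y + w [mod N ]
  +-cong-mod {x} {y} {u} {w} (k , l , e) (k′ , l′ , e′) = k + k′ , l + l′ , (begin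
    x + u + (k + k′) * N       ≡⟨ solve (x ∷ u ∷ k ∷ k′ ∷ N ∷ []) ⟩
    (x + k * N) + (u + k′ * N) ≡⟨ cong₂ _+_ e e′ ⟩
    (y + l * N) + (w + l′ * N) ≡⟨ solve (y ∷ w ∷ l ∷ l′ ∷ N ∷ []) ⟩
    y + w + (l + l′) * N       ∎)
    where open ≡-Reasoning

  *-congˡ-mod : ∀ q {x y} → x ≡ y [mod N ] → q * x ≡ q * y [mod N ]
  *-congˡ-mod q {x} {y} (k , l , e) = q * k , q * l , (begin
    q * x + q * k * N ≡⟨ solve (q ∷ x ∷ k ∷ N ∷ []) ⟩
    q * (x + k * N)   ≡⟨ cong (q *_) e ⟩
    q * (y + l * N)   ≡⟨ solve (q ∷ y ∷ l ∷ N ∷ []) ⟩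
    q * y + q * l * N ∎)
    where open ≡-Reasoning

  +-cancelʳ-mod : ∀ z {x y} → x + z ≡ y + z [mod N ] → x ≡ y [mod N ]
  +-cancelʳ-mod z {x} {y} (k , l , e) = k , l , +-cancelʳ-≡ z _ _ (begin
    x + k * N + z ≡⟨ solve (x ∷ k ∷ N ∷ z ∷ []) ⟩
    x + z + k * N ≡⟨ e ⟩
    y + z + l * N ≡⟨ solve (y ∷ z ∷ l ∷ N ∷ []) ⟩
    y + l * N + z ∎)
    where open ≡-Reasoning

  m+kn≡m-mod : ∀ x k → x + k * N ≡ x [mod N ]
  m+kn≡m-mod x k = 0 , k , +-identityʳ (x + k * N)

  ≡-mod-∣ : ∀ {d x y} → d ∣ N → x ≡ y [mod N ] → x ≡ y [mod d ]
  ≡-mod-∣ {d} {x} {y} (divides q refl) (k , l , e) = k * q , l * q , (begin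
    x + k * q * d   ≡⟨ cong (x +_) (*-assoc k q d) ⟩
    x + k * (q * d) ≡⟨ e ⟩
    y + l * (q * d) ≡⟨ cong (y +_) (sym (*-assoc l q d)) ⟩
    y + l * q * d   ∎)
    where open ≡-Reasoning

  ≡-mod⇒%≡ : .{{_ : NonZero N}} → ∀ {x y} → x ≡ y [mod N ] → x % N ≡ y % N
  ≡-mod⇒%≡ {x} {y} (k , l , e) = begin
    x % N           ≡⟨ [m+kn]%n≡m%n x k N ⟨
    (x + k * N) % N ≡⟨ cong (_% N) e ⟩
    (y + l * N) % N ≡⟨ [m+kn]%n≡m%n y l N ⟩
    y % N           ∎
    where open ≡-Reasoning

  ≡0-mod⇒∣ : ∀ {x} → x ≡ 0 [mod N ] → N ∣ x
  ≡0-mod⇒∣ {x} (k , l , e) =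
    ∣m+n∣m⇒∣n (divides l (trans (+-comm (k * N) x) e)) (n∣m*n k)

≡-mod-setoid : ℕ → Setoid 0ℓ 0ℓ
≡-mod-setoid N = record
  { Carrier       = ℕ
  ; _≈_           = λ x y → x ≡ y [mod N ]
  ; isEquivalence = record { refl = ≡-mod-refl ; sym = ≡-mod-sym ; trans = ≡-mod-trans }
  }

module ≡-mod-Reasoning (N : ℕ) = SetoidReasoning (≡-mod-setoid N)

-- t₋₁ and t are |tᵢ₋₁| and |tᵢ|, where rᵢ ≡ tᵢ v (mod u) and tᵢ has sign (-1)ⁱ.
data CofactorSigns (u v a b t₋₁ t : ℕ) : Set where
  even : t * v ≡ b [mod u ] → a + t₋₁ * v ≡ 0 [mod u ] → CofactorSigns u v a b t₋₁ t
  odd  : b + t * v ≡ 0 [mod u ] → t₋₁ * v ≡ a [mod u ] → CofactorSigns u v a b t₋₁ t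

record Cofactors (u v a b : ℕ) : Set where
  constructor cofactors
  field
    t₋₁ t      : ℕ
    continuant : t * a + t₋₁ * b ≡ u
    signs      : CofactorSigns u v a b t₋₁ t

module _ {u v : ℕ} where

  cofactors-start : Cofactors u v u v
  cofactors-start = cofactors 0 1 (solve (u ∷ v ∷ []))
    (even (0 , 0 , cong (_+ 0) (*-identityˡ v)) (0 , 1 , solve (u ∷ v ∷ [])))

  cofactors-step : ∀ {q b r} → Cofactors u v (r + q * b) b → Cofactors u v b r
  cofactors-step {q} {b} {r} (cofactors t₋₁ t continuant signs) =
    cofactors t (t₋₁ + q * t) continuant′ (signs-step signs)
    where
    continuant′ : (t₋₁ + q * t) * b + t * r ≡ u
    continuant′ = begin
      (t₋₁ + q * t) * b + t * r ≡⟨ solve (t₋₁ ∷ q ∷ t ∷ b ∷ r ∷ []) ⟩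
      t * (r + q * b) + t₋₁ * b ≡⟨ continuant ⟩
      u                         ∎
      where open ≡-Reasoning

    signs-step : CofactorSigns u v (r + q * b) b t₋₁ t → CofactorSigns u v b r t (t₋₁ + q * t)
    signs-step (even tv≡b a+t₋₁v≡0) = odd (begin
      r + (t₋₁ + q * t) * v   ≡⟨ solve (r ∷ t₋₁ ∷ q ∷ t ∷ v ∷ []) ⟩
      r + t₋₁ * v + q * (t * v) ≈⟨ +-cong-mod ≡-mod-refl (*-congˡ-mod q tv≡b) ⟩
      r + t₋₁ * v + q * b     ≡⟨ solve (r ∷ t₋₁ ∷ v ∷ q ∷ b ∷ []) ⟩
      r + q * b + t₋₁ * v     ≈⟨ a+t₋₁v≡0 ⟩
      0                       ∎) tv≡b
      where open ≡-mod-Reasoning u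
    signs-step (odd b+tv≡0 t₋₁v≡a) = even (begin
      (t₋₁ + q * t) * v       ≡⟨ solve (t₋₁ ∷ q ∷ t ∷ v ∷ []) ⟩
      t₋₁ * v + q * (t * v)   ≈⟨ +-cong-mod t₋₁v≡a ≡-mod-refl ⟩
      r + q * b + q * (t * v) ≡⟨ solve (r ∷ q ∷ b ∷ t ∷ v ∷ []) ⟩
      r + q * (b + t * v)     ≈⟨ +-cong-mod ≡-mod-refl (*-congˡ-mod q b+tv≡0) ⟩
      r + q * 0               ≡⟨ solve (r ∷ q ∷ []) ⟩
      r                       ∎) b+tv≡0
      where open ≡-mod-Reasoning u

cofactorsAt : ∀ u v i → Cofactors u v (proj₁ (pairAt u v i)) (rem u v i)
cofactorsAt u v zero = cofactors-start
cofactorsAt u v (suc i) with pairAt u v i | cofactorsAt u v i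
... | a , zero  | C = C
... | a , suc b | C =
  cofactors-step {q = a / suc b} (subst (λ x → Cofactors u v x (suc b)) (m≡m%n+[m/n]*n a (suc b)) C)

rem-≤-∸ : ∀ u v i → rem u v i ≤ v ∸ i
rem-≤-∸ u v zero = ≤-refl
rem-≤-∸ u v (suc i) with pairAt u v i | rem-≤-∸ u v i
... | a , zero  | _      = z≤n
... | a , suc b | b<v∸i = subst (a % suc b ≤_) (pred[m∸n]≡m∸[1+n] v i)
                            (pred-mono-≤ (≤-trans (m%n<n a (suc b)) b<v∸i))

rem-suc-v≡0 : ∀ u v → rem u v (suc v) ≡ 0
rem-suc-v≡0 u v = n≤0⇒n≡0 (subst (rem u v (suc v) ≤_) (m≤n⇒m∸n≡0 (n≤1+n v)) (rem-≤-∸ u v (suc v)))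

proj₁-pairAt-suc : ∀ u v i → 0 < rem u v i → proj₁ (pairAt u v (suc i)) ≡ rem u v i
proj₁-pairAt-suc u v i 0<r with pairAt u v i
... | a , suc b = refl

∃-least : ∀ {p} {P : Pred ℕ p} → Decidable P → ∀ {n} → P n →
          ∃ λ i → P i × (∀ {j} → j < i → ¬ P j)
∃-least {P = P} P? {n} Pn with search (suc n)
  where
  search : ∀ k → (∃ λ i → P i × (∀ {j} → j < i → ¬ P j)) ⊎ (∀ {j} → j < k → ¬ P j)
  search zero = inj₂ λ ()
  search (suc k) with search k
  ... | inj₁ least = inj₁ least
  ... | inj₂ none with P? k
  ...   | yes Pk = inj₁ (k , Pk , none)
  ...   | no ¬Pk = inj₂ λ j<1+k → [ none , (λ { refl → ¬Pk }) ]′ (m<1+n⇒m<n∨m≡n j<1+k)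
... | inj₁ least = least
... | inj₂ none  = ⊥-elim (none ≤-refl Pn)

n^2≡n*n : ∀ n → n ^ 2 ≡ n * n
n^2≡n*n n = cong (n *_) (*-identityʳ n)

n≡1⇒m%n≡o%n : ∀ {n} .{{_ : NonZero n}} m o → n ≡ 1 → m % n ≡ o % n
n≡1⇒m%n≡o%n m o refl = trans (n%1≡0 m) (sym (n%1≡0 o))

module _ {n : ℕ} .{{_ : NonZero n}} where

  n∣m∧0<m<2n⇒m≡n : ∀ {m} → n ∣ m → 0 < m → m < n + n → m ≡ n
  n∣m∧0<m<2n⇒m≡n (divides zero refl)          ()
  n∣m∧0<m<2n⇒m≡n (divides (suc zero) refl)    _ _ = +-identityʳ n
  n∣m∧0<m<2n⇒m≡n (divides (suc (suc q)) refl) _ m<2n =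
    ⊥-elim (<⇒≱ m<2n (+-monoʳ-≤ n (m≤m+n n (q * n))))

  ≡0-mod-n^2⇒∣ : ∀ {x} → x ≡ 0 [mod n ^ 2 ] → n * n ∣ x
  ≡0-mod-n^2⇒∣ {x} x≡0 = subst (_∣ x) (n^2≡n*n n) (≡0-mod⇒∣ x≡0)

  cofactor-≤ : ∀ {v a b} → n ≤ a → (C : Cofactors (n ^ 2) v a b) → Cofactors.t C ≤ n
  cofactor-≤ {a = a} {b} n≤a (cofactors t₋₁ t continuant _) = *-cancelʳ-≤ t n n (begin
    t * n             ≤⟨ *-monoʳ-≤ t n≤a ⟩
    t * a             ≤⟨ m≤m+n (t * a) (t₋₁ * b) ⟩
    t * a + t₋₁ * b   ≡⟨ continuant ⟩
    n ^ 2             ≡⟨ n^2≡n*n n ⟩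
    n * n             ∎)
    where open ≤-Reasoning

  cofactor-or-remainder-nonzero : ∀ {v a b} → (C : Cofactors (n ^ 2) v a b) → 0 < Cofactors.t C + b
  cofactor-or-remainder-nonzero           (cofactors _   (suc _) _ _)          = z<s
  cofactor-or-remainder-nonzero {b = suc _} (cofactors _   zero    _ _)        = z<s
  cofactor-or-remainder-nonzero {b = zero}  (cofactors t₋₁ zero    continuant _) =
    ⊥-elim (<⇒≢ (m^n>0 n 2) (trans (sym (*-zeroʳ t₋₁)) continuant))

module _ {m n : ℕ} .{{_ : NonZero n}} where

  odd-sign⇒inverse : ∀ {b t} → b + t * (m * n + 1) ≡ 0 [mod n ^ 2 ] →
                     0 < t + b → t ≤ n → b < n → (m * b) % n ≡ 1 % n
  odd-sign⇒inverse {b} {t} b+tv≡0 0<t+b t≤n b<n = begin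
    (m * b) % n               ≡⟨ %-remove-+ʳ (m * b) n∣1+tm ⟨
    (m * b + (1 + t * m)) % n ≡⟨ cong (_% n) (solve (m ∷ b ∷ t ∷ [])) ⟩
    (1 + m * (t + b)) % n     ≡⟨ cong (λ x → (1 + m * x) % n) t+b≡n ⟩
    (1 + m * n) % n           ≡⟨ [m+kn]%n≡m%n 1 m n ⟩
    1 % n                     ∎
    where
    open ≡-Reasoning
    b+tv≡tmn+t+b : b + t * (m * n + 1) ≡ t * m * n + (t + b)
    b+tv≡tmn+t+b = solve (b ∷ t ∷ m ∷ n ∷ [])

    n∣b+tv : n ∣ b + t * (m * n + 1)
    n∣b+tv = ∣-trans (n∣m*n n) (≡0-mod-n^2⇒∣ b+tv≡0)

    t+b≡n : t + b ≡ n
    t+b≡n = n∣m∧0<m<2n⇒m≡n (∣m+n∣m⇒∣n (subst (n ∣_) b+tv≡tmn+t+b n∣b+tv) (n∣m*n (t * m)))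
              0<t+b (+-mono-≤-< t≤n b<n)

    n∣1+tm : n ∣ 1 + t * m
    n∣1+tm = *-cancelˡ-∣ n (subst (n * n ∣_) (begin
      b + t * (m * n + 1)   ≡⟨ b+tv≡tmn+t+b ⟩
      t * m * n + (t + b)   ≡⟨ cong (t * m * n +_) t+b≡n ⟩
      t * m * n + n         ≡⟨ solve (t ∷ m ∷ n ∷ []) ⟩
      n * (1 + t * m)       ∎) (≡0-mod-n^2⇒∣ b+tv≡0))

  even-sign⇒t%n≡b : ∀ {b t} → t * (m * n + 1) ≡ b [mod n ^ 2 ] → b < n → t % n ≡ b
  even-sign⇒t%n≡b {b} {t} tv≡b b<n = trans (≡-mod⇒%≡ (begin
    t               ≈⟨ m+kn≡m-mod t (t * m) ⟨
    t + t * m * n   ≡⟨ solve (t ∷ m ∷ n ∷ []) ⟩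
    t * (m * n + 1) ≈⟨ ≡-mod-∣ (m∣m*n (n ^ 1)) tv≡b ⟩
    b               ∎)) (m<n⇒m%n≡m b<n)
    where open ≡-mod-Reasoning n

  even-sign⇒n≡1 : ∀ {b t} → Coprime m n → t * (m * n + 1) ≡ b [mod n ^ 2 ] →
                  0 < t + b → t ≤ n → b < n → n ≡ 1
  even-sign⇒n≡1 {b} {t} coprime tv≡b 0<t+b t≤n b<n with m≤n⇒m<n∨m≡n t≤n
  ... | inj₁ t<n = ⊥-elim (<⇒≢ 0<t+b (sym (cong₂ _+_ t≡0 b≡0)))
    where
    t≡b : t ≡ b
    t≡b = trans (sym (m<n⇒m%n≡m t<n)) (even-sign⇒t%n≡b tv≡b b<n)

    mbn≡0 : m * b * n ≡ 0 [mod n ^ 2 ]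
    mbn≡0 = +-cancelʳ-mod b (begin
      m * b * n + b   ≡⟨ solve (b ∷ m ∷ n ∷ []) ⟩
      b * (m * n + 1) ≡⟨ cong (λ x → x * (m * n + 1)) t≡b ⟨
      t * (m * n + 1) ≈⟨ tv≡b ⟩
      b               ∎)
      where open ≡-mod-Reasoning (n ^ 2)

    n∣b : n ∣ b
    n∣b = coprime-divisor (Coprime-sym coprime) (*-cancelʳ-∣ n (≡0-mod-n^2⇒∣ mbn≡0))

    b≡0 : b ≡ 0
    b≡0 = trans (sym (m<n⇒m%n≡m b<n)) (n∣m⇒m%n≡0 b n n∣b)

    t≡0 : t ≡ 0
    t≡0 = trans t≡b b≡0
  ... | inj₂ refl = ∣1⇒≡1 (∣m+n∣m⇒∣n n∣mn+1 (n∣m*n m))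
    where
    b≡0 : b ≡ 0
    b≡0 = trans (sym (even-sign⇒t%n≡b tv≡b b<n)) (n%n≡0 n)

    n∣mn+1 : n ∣ m * n + 1
    n∣mn+1 = *-cancelˡ-∣ n
      (≡0-mod-n^2⇒∣ (subst (λ x → n * (m * n + 1) ≡ x [mod n ^ 2 ]) b≡0 tv≡b))

  cofactors⇒inverse : ∀ {a b} → Coprime m n → n ≤ a → b < n → Cofactors (n ^ 2) (m * n + 1) a b →
                      (m * b) % n ≡ 1 % n
  cofactors⇒inverse {a} {b} coprime n≤a b<n C@(cofactors t₋₁ t _ signs) = from-signs signs
    where
    t≤n : t ≤ n
    t≤n = cofactor-≤ n≤a C

    0<t+b : 0 < t + b
    0<t+b = cofactor-or-remainder-nonzero C

    from-signs : CofactorSigns (n ^ 2) (m * n + 1) a b t₋₁ t → (m * b) % n ≡ 1 % n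
    from-signs (even tv≡b _)   = n≡1⇒m%n≡o%n (m * b) 1 (even-sign⇒n≡1 coprime tv≡b 0<t+b t≤n b<n)
    from-signs (odd b+tv≡0 _) = odd-sign⇒inverse b+tv≡0 0<t+b t≤n b<n

mainTheorem2 : (m n : ℕ) → 0 < m → .{{_ : NonZero n}} → Coprime m n →
    Σ ℕ (λ i → 1 ≤ i × rem (n ^ 2) (m * n + 1) i < n
      × ((j : ℕ) → 1 ≤ j → j < i → rem (n ^ 2) (m * n + 1) j ≥ n))
    × ((i : ℕ) → 1 ≤ i → rem (n ^ 2) (m * n + 1) i < n →
      ((j : ℕ) → 1 ≤ j → j < i → rem (n ^ 2) (m * n + 1) j ≥ n) →
      (m * rem (n ^ 2) (m * n + 1) i) % n ≡ 1 % n)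
mainTheorem2 m n 0<m coprime = first-small , first-small-is-inverse
  where
  R : ℕ → ℕ
  R = rem (n ^ 2) (m * n + 1)

  eventually-small : R (suc (m * n + 1)) < n
  eventually-small = subst (_< n) (sym (rem-suc-v≡0 (n ^ 2) (m * n + 1))) (>-nonZero⁻¹ n)

  first-small : Σ ℕ λ i → 1 ≤ i × R i < n × (∀ j → 1 ≤ j → j < i → R j ≥ n)
  first-small with ∃-least (λ k → R (suc k) <? n) {m * n + 1} eventually-small
  ... | k , R1+k<n , below =
    suc k , s≤s z≤n , R1+k<n , λ { (suc j) _ (s≤s j<k) → ≮⇒≥ (below j<k) }

  previous-large : ∀ k → (∀ j → 1 ≤ j → j < suc k → R j ≥ n) → R k ≥ n
  previous-large zero    _     = m≤n⇒m≤n+o 1 (m≤n*m n m {{>-nonZero 0<m}})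
  previous-large (suc k) below = below (suc k) (s≤s z≤n) ≤-refl

  first-small-is-inverse : ∀ i → 1 ≤ i → R i < n → (∀ j → 1 ≤ j → j < i → R j ≥ n) →
                           (m * R i) % n ≡ 1 % n
  first-small-is-inverse (suc k) _ R1+k<n below = cofactors⇒inverse coprime
    (subst (n ≤_) (sym (proj₁-pairAt-suc (n ^ 2) (m * n + 1) k 0<Rk)) n≤Rk) R1+k<n
    (cofactorsAt (n ^ 2) (m * n + 1) (suc k))
    where
    n≤Rk : n ≤ R k
    n≤Rk = previous-large k below
    0<Rk : 0 < R k
    0<Rk = <-≤-trans (>-nonZero⁻¹ n) n≤Rk
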